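{- Let $P\in\mathfrak{P}$ and let $Y,Z$ be nonempty finite sets. For a map $\xi$ from the carrier of $P$ to $Y\times Z$, let $\xi_1:P\to Y$ and $\xi_2:P\to Z$ be defined by $(\xi_1(x),\xi_2(x))=\xi(x)$. Then for all $x\in P$, $G_\xi(x)=\gamma_{G_{\xi_1}(x)\cap G_{\xi_2}(x)}(x)$.
   Context: $\mathfrak{P}$ is the class of finite nonempty posets. For a poset $P$, $A\subseteq P$ and $x\in A$, $\gamma_A(x)$ is the set of $y\in A$ such that there are $x=z_0,z_1,\dots,z_L=y$ in $A$ ($L\ge0$) with $z_{\ell-1}<z_\ell$ or $z_{\ell-1}>z_\ell$ for all $\ell$. For a map $\xi$ from the carrier of $P$ to a set and $x\in P$, $G_\xi(x):=\gamma_{\xi^{ -1}(\xi(x))}(x)$. -}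

module Defs where

open import Data.Nat using (ℕ)
open import Data.Fin using (Fin)
open import Data.Product using (_×_)
open import Data.Sum using (_⊎_)
open import Relation.Binary.PropositionalEquality using (_≡_)
open import Relation.Nullary using (¬_)

-- A finite poset with carrier Fin n, given by a relation _≼_ (partial order
-- w.r.t. propositional equality is assumed in the statement).
-- Strict order x < y  :=  x ≼ y and x ≢ y.
module _ {n : ℕ} (_≼_ : Fin n → Fin n → Set) where

  _≺_ : Fin n → Fin n → Set
  x ≺ y = (x ≼ y) × ¬ (x ≡ y)

  data Reach (A : Fin n → Set) (x : Fin n) : Fin n → Set where
    here : A x → Reach A x x
    step : ∀ {z w} → Reach A x z → A w → (z ≺ w) ⊎ (w ≺ z) → Reach A x w

  γ : (Fin n → Set) → Fin n → Fin n → Set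
  γ A x = Reach A x

  G : {B : Set} → (Fin n → B) → Fin n → Fin n → Set
  G ξ x = γ (λ y → ξ y ≡ ξ x) x

_∩_ : {n : ℕ} → (Fin n → Set) → (Fin n → Set) → Fin n → Set
(A ∩ B) y = A y × B y

module Submission where

open import Defs
open import Data.Nat using (ℕ; suc)
open import Data.Fin using (Fin)
open import Data.Product using (_×_; proj₁; proj₂; _,_)
open import Relation.Binary.PropositionalEquality using (_≡_; cong; cong₂)
open import Relation.Binary.Structures using (IsPartialOrder)
open import Function.Bundles using (_⇔_; mk⇔)

-- A path inside the fibre of ξ = (ξ₁ , ξ₂) through x stays in the fibres of ξ₁
-- and ξ₂, and each of its prefixes witnesses that the current point lies in
-- G ξ₁ x and G ξ₂ x; conversely a point of G ξ₁ x ∩ G ξ₂ x has both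
-- coordinates equal to those of ξ x. No order axioms are needed.

module _ {n : ℕ} (_≼_ : Fin n → Fin n → Set) where

  Reach-mono : ∀ {A B : Fin n → Set} {x y} →
               (∀ {z} → A z → B z) → Reach _≼_ A x y → Reach _≼_ B x y
  Reach-mono A⊆B (here a)       = here (A⊆B a)
  Reach-mono A⊆B (step r a cmp) = step (Reach-mono A⊆B r) (A⊆B a) cmp

  Reach-target : ∀ {A : Fin n → Set} {x y} → Reach _≼_ A x y → A y
  Reach-target (here a)     = a
  Reach-target (step _ a _) = a

  Reach-within-component : ∀ {A : Fin n → Set} {x y} →
                           Reach _≼_ A x y → Reach _≼_ (Reach _≼_ A x) x y
  Reach-within-component r@(here _)       = here r
  Reach-within-component r@(step r′ _ cmp) = step (Reach-within-component r′) r cmp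

  G-pair⇔γ-∩ : ∀ {B C : Set} (ξ : Fin n → B × C) (x y : Fin n) →
               G _≼_ ξ x y
               ⇔ γ _≼_ (G _≼_ (λ u → proj₁ (ξ u)) x ∩ G _≼_ (λ u → proj₂ (ξ u)) x) x y
  G-pair⇔γ-∩ ξ x y = mk⇔ to from
    where
    to : G _≼_ ξ x y → γ _≼_ (G _≼_ (λ u → proj₁ (ξ u)) x ∩ G _≼_ (λ u → proj₂ (ξ u)) x) x y
    to r = Reach-mono (λ r′ → Reach-mono (cong proj₁) r′ , Reach-mono (cong proj₂) r′)
                      (Reach-within-component r)

    from : γ _≼_ (G _≼_ (λ u → proj₁ (ξ u)) x ∩ G _≼_ (λ u → proj₂ (ξ u)) x) x y → G _≼_ ξ x y
    from = Reach-mono (λ (r₁ , r₂) → cong₂ _,_ (Reach-target r₁) (Reach-target r₂))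

lemma2 : (m : ℕ) (_≼_ : Fin (suc m) → Fin (suc m) → Set)
         → IsPartialOrder _≡_ _≼_
         → (a b : ℕ) (ξ : Fin (suc m) → Fin (suc a) × Fin (suc b))
         → (x y : Fin (suc m))
         → G _≼_ ξ x y
           ⇔ γ _≼_ (_∩_ (G _≼_ (λ u → proj₁ (ξ u)) x) (G _≼_ (λ u → proj₂ (ξ u)) x)) x y
lemma2 m _≼_ _ a b = G-pair⇔γ-∩ _≼_
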